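{- For every digraph $G$, its block graph $F$ is acyclic.
   Context: Let $G=(V,E)$ be a digraph. Two distinct vertices $v,w$ are vertex-resilient, written $v\leftrightarrow_{\mathrm{vr}} w$, if for every vertex $z\notin\{v,w\}$, $v$ and $w$ lie in the same strongly connected component of $G\setminus z$. A vertex-resilient block is a maximal set $B\subseteq V$ with $|B|\ge 2$ such that $u\leftrightarrow_{\mathrm{vr}} v$ for all distinct $u,v\in B$. The block graph $F$ of $G$ is the undirected bipartite graph whose vertex set consists of the vertices of $V$ together with one block node for each vertex-resilient block of $G$, and whose edges are the pairs $\{u,B\}$ with $u\in B$. -}

module Defs where

open import Data.Nat using (ℕ; _≤_)
open import Data.Fin using (Fin)
open import Data.Fin.Subset using (Subset; _∈_; _⊆_)
open import Data.Product using (Σ; ∃; ∃-syntax; _×_; _,_)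
open import Data.Sum using (_⊎_; inj₁; inj₂)
open import Data.Empty using (⊥)
open import Data.List using (List; []; _∷_; _++_; [_]; length)
open import Data.List.Relation.Unary.Linked using (Linked)
open import Data.List.Relation.Unary.Unique.Propositional using (Unique)
open import Relation.Binary.PropositionalEquality using (_≡_; _≢_)
open import Relation.Nullary using (¬_)

Digraph : ℕ → Set₁
Digraph n = Fin n → Fin n → Set

module _ {n : ℕ} (G : Digraph n) where

  -- Reach z u v : there is a directed path from u to v in G \ z
  -- (all vertices of the path, including u and v, differ from z).
  data Reach (z : Fin n) : Fin n → Fin n → Set where
    here : ∀ {u} → u ≢ z → Reach z u u
    step : ∀ {u w v} → u ≢ z → G u w → Reach z w v → Reach z u v

  SameSCC : Fin n → Fin n → Fin n → Set
  SameSCC z u v = Reach z u v × Reach z v u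

  VR : Fin n → Fin n → Set
  VR v w = v ≢ w × (∀ z → z ≢ v → z ≢ w → SameSCC z v w)

  PairwiseVR : Subset n → Set
  PairwiseVR B = ∀ u v → u ∈ B → v ∈ B → u ≢ v → VR u v

  IsBlock : Subset n → Set
  IsBlock B =
    (∃[ u ] ∃[ v ] (u ∈ B × v ∈ B × u ≢ v))
    × PairwiseVR B
    × (∀ B′ → B ⊆ B′ → PairwiseVR B′ → B′ ⊆ B)

  -- Nodes of the block graph F: vertices of G (inj₁) and block nodes (inj₂),
  -- a block node being identified with its vertex set. Subsets that are not
  -- blocks are included only as isolated dummy nodes (no incident edges).
  Node : Set
  Node = Fin n ⊎ Subset n

  Adj : Node → Node → Set
  Adj (inj₁ u) (inj₂ B) = IsBlock B × u ∈ B
  Adj (inj₂ B) (inj₁ u) = IsBlock B × u ∈ B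
  Adj _ _ = ⊥

  Cycle : Set
  Cycle = Σ Node λ x → Σ (List Node) λ rest →
            3 ≤ length (x ∷ rest)
            × Unique (x ∷ rest)
            × Linked Adj (x ∷ rest ++ [ x ])

  BlockGraphAcyclic : Set
  BlockGraphAcyclic = ¬ Cycle

module Submission where

-- Say that two nodes x, y of F are joined in G \ z if every vertex of x and
-- every vertex of y, both different from z, lie in one strongly connected
-- component of G \ z.  Adjacent nodes of F are joined in every G \ z (that is
-- what a block means), and joinedness is transitive through any middle node
-- having a vertex other than z; hence a path of F whose interior avoids the
-- vertex node z joins its endpoints in G \ z.
--
-- If two blocks B, B′ are joined in every G \ z, then B ∪ B′ is pairwise
-- vertex-resilient and maximality forces B = B′.  In particular two blocks
-- sharing a vertex v coincide as soon as they stay joined in G \ v.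
--
-- A cycle of F alternates between vertex and block nodes, so it contains
-- distinct blocks B, B′ sharing a vertex v; the rest of the cycle is a path
-- from B′ to B avoiding v, which joins them in G \ v — a contradiction.

open import Defs
open import Data.Nat using (ℕ; s≤s)
open import Data.Fin using (Fin; _≟_)
open import Data.Fin.Subset using (Subset; _∈_; _∪_)
open import Data.Fin.Subset.Properties using (p⊆p∪q; q⊆p∪q; x∈p∪q⁻; ⊆-antisym)
open import Data.Product using (∃-syntax; _×_; _,_; proj₁; proj₂)
open import Data.Sum using (inj₁; inj₂)
open import Data.List using ([]; _∷_; _++_; [_])
open import Data.List.Relation.Unary.Linked using (Linked; [-]; _∷_)
open import Data.List.Relation.Unary.All using (All; []; _∷_)
open import Data.List.Relation.Unary.AllPairs using (_∷_)
open import Relation.Binary.PropositionalEquality using (_≡_; _≢_; refl; sym; cong)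
open import Relation.Nullary using (¬_; yes; no)

module _ {n : ℕ} (G : Digraph n) where

  reach-trans : ∀ {z u w v} → Reach G z u w → Reach G z w v → Reach G z u v
  reach-trans (here _)      r = r
  reach-trans (step p e r₁) r = step p e (reach-trans r₁ r)

  sameSCC-sym : ∀ {z u v} → SameSCC G z u v → SameSCC G z v u
  sameSCC-sym (uv , vu) = vu , uv

  sameSCC-trans : ∀ {z u w v} → SameSCC G z u w → SameSCC G z w v → SameSCC G z u v
  sameSCC-trans (uw , wu) (wv , vw) = reach-trans uw wv , reach-trans vw wu

  _∈ₙ_ : Fin n → Node G → Set
  u ∈ₙ inj₁ w = u ≡ w
  u ∈ₙ inj₂ B = u ∈ B

  Joined : Fin n → Node G → Node G → Set
  Joined z x y = ∀ u v → u ∈ₙ x → v ∈ₙ y → z ≢ u → z ≢ v → SameSCC G z u v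

  joined-sym : ∀ {z x y} → Joined z x y → Joined z y x
  joined-sym xy u v u∈y v∈x zu zv = sameSCC-sym (xy v u v∈x u∈y zv zu)

  joined-via : ∀ {z x y t} w → w ∈ₙ y → z ≢ w → Joined z x y → Joined z y t → Joined z x t
  joined-via w w∈y zw xy yt u v u∈x v∈t zu zv =
    sameSCC-trans (xy u w u∈x w∈y zu zw) (yt w v w∈y v∈t zw zv)

  block-joined : ∀ {z a B} → IsBlock G B → a ∈ B → Joined z (inj₁ a) (inj₂ B)
  block-joined {z} (_ , pairwise , _) a∈B u v refl v∈B zu zv with u ≟ v
  ... | yes refl = here (λ uz → zu (sym uz)) , here (λ uz → zu (sym uz))
  ... | no u≢v   = proj₂ (pairwise u v a∈B v∈B u≢v) z zu zv

  adj⇒joined : ∀ {z x y} → Adj G x y → Joined z x y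
  adj⇒joined {x = inj₁ a} {inj₂ B} (block , a∈B) = block-joined block a∈B
  adj⇒joined {x = inj₂ B} {inj₁ a} (block , a∈B) = joined-sym (block-joined block a∈B)

  block-avoids : ∀ {B} z → IsBlock G B → ∃[ w ] (w ∈ B × z ≢ w)
  block-avoids z ((u , v , u∈B , v∈B , u≢v) , _) with z ≟ u
  ... | yes refl = v , v∈B , u≢v
  ... | no z≢u   = u , u∈B , z≢u

  adj-target-avoids : ∀ {z x y} → Adj G x y → inj₁ z ≢ y → ∃[ w ] (w ∈ₙ y × z ≢ w)
  adj-target-avoids {z} {inj₂ B} {inj₁ w} _           z≢y = w , refl , λ zw → z≢y (cong inj₁ zw)
  adj-target-avoids {z} {inj₁ a} {inj₂ B} (block , _) _   = block-avoids z block

  path⇒joined : ∀ {z} x ys y → Linked (Adj G) (x ∷ ys ++ [ y ]) → All (λ t → inj₁ z ≢ t) ys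
              → Joined z x y
  path⇒joined x []       y (xy ∷ [-]) []          = adj⇒joined xy
  path⇒joined x (t ∷ ys) y (xt ∷ ty)  (z≢t ∷ z≢ys) =
    let (w , w∈t , zw) = adj-target-avoids xt z≢t
    in joined-via w w∈t zw (adj⇒joined xt) (path⇒joined t ys y ty z≢ys)

  union-pairwiseVR : ∀ {B B′} → IsBlock G B → IsBlock G B′
                   → (∀ z → Joined z (inj₂ B) (inj₂ B′)) → PairwiseVR G (B ∪ B′)
  union-pairwiseVR {B} {B′} (_ , vrB , _) (_ , vrB′ , _) joined u v u∈ v∈ u≢v
    with x∈p∪q⁻ B B′ u∈ | x∈p∪q⁻ B B′ v∈
  ... | inj₁ u∈B  | inj₁ v∈B  = vrB u v u∈B v∈B u≢v
  ... | inj₂ u∈B′ | inj₂ v∈B′ = vrB′ u v u∈B′ v∈B′ u≢v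
  ... | inj₁ u∈B  | inj₂ v∈B′ = u≢v , λ z zu zv → joined z u v u∈B v∈B′ zu zv
  ... | inj₂ u∈B′ | inj₁ v∈B  = u≢v , λ z zu zv → joined-sym (joined z) u v u∈B′ v∈B zu zv

  joined-blocks-coincide : ∀ {B B′} → IsBlock G B → IsBlock G B′
                         → (∀ z → Joined z (inj₂ B) (inj₂ B′)) → B ≡ B′
  joined-blocks-coincide {B} {B′} blockB blockB′ joined =
    ⊆-antisym (λ u∈B → maximal′ (B ∪ B′) (q⊆p∪q B B′) vr (p⊆p∪q B′ u∈B))
              (λ u∈B′ → maximal (B ∪ B′) (p⊆p∪q B′) vr (q⊆p∪q B B′ u∈B′))
    where
      vr = union-pairwiseVR blockB blockB′ joined
      maximal = proj₂ (proj₂ blockB)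
      maximal′ = proj₂ (proj₂ blockB′)

  -- Two blocks sharing a vertex v coincide if they stay joined in G \ v:
  -- in every other G \ z they are joined through v itself.
  shared-blocks-coincide : ∀ {B B′ v} → IsBlock G B → IsBlock G B′ → v ∈ B → v ∈ B′
                         → Joined v (inj₂ B) (inj₂ B′) → B ≡ B′
  shared-blocks-coincide {B} {B′} {v} blockB blockB′ v∈B v∈B′ joined-v =
    joined-blocks-coincide blockB blockB′ joined
    where
      joined : ∀ z → Joined z (inj₂ B) (inj₂ B′)
      joined z with z ≟ v
      ... | yes refl = joined-v
      ... | no z≢v   = joined-via v refl z≢v (joined-sym (block-joined blockB v∈B))
                                             (block-joined blockB′ v∈B′)

  -- The configuration every cycle of F contains: two distinct blocks sharing
  -- a vertex v, with B′ still joined to B in G \ v.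
  record RejoinedBlocks : Set where
    field
      B B′     : Subset n
      v        : Fin n
      blockB   : IsBlock G B
      blockB′  : IsBlock G B′
      v∈B      : v ∈ B
      v∈B′     : v ∈ B′
      distinct : B ≢ B′
      joined   : Joined v (inj₂ B′) (inj₂ B)

  no-rejoined-blocks : ¬ RejoinedBlocks
  no-rejoined-blocks r = distinct (shared-blocks-coincide blockB blockB′ v∈B v∈B′ (joined-sym joined))
    where open RejoinedBlocks r

  -- Read off two consecutive blocks B, v, B′ of a cycle (rotating it by one
  -- step if it starts at a vertex node); the rest of the cycle returns from
  -- B′ to B avoiding v.  Uniqueness of the cycle's nodes supplies B ≠ B′ and
  -- the avoidance; 3-cycles are excluded since F is bipartite.
  cycle⇒rejoined : Cycle G → RejoinedBlocks
  cycle⇒rejoined (inj₂ B , inj₁ v ∷ inj₂ B′ ∷ rest , _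
                 , ((_ ∷ B≢B′ ∷ _) ∷ (_ ∷ v≢rest) ∷ _) , (Bv ∷ vB′ ∷ back)) = record
    { B = B ; B′ = B′ ; v = v
    ; blockB = proj₁ Bv ; blockB′ = proj₁ vB′ ; v∈B = proj₂ Bv ; v∈B′ = proj₂ vB′
    ; distinct = λ B≡B′ → B≢B′ (cong inj₂ B≡B′)
    ; joined = path⇒joined (inj₂ B′) rest (inj₂ B) back v≢rest }
  cycle⇒rejoined (inj₁ a , inj₂ B ∷ inj₁ b ∷ inj₂ B′ ∷ rest , _
                 , ((_ ∷ a≢b ∷ _) ∷ (_ ∷ B≢B′ ∷ _) ∷ (_ ∷ b≢rest) ∷ _) , (aB ∷ Bb ∷ bB′ ∷ back)) = record
    { B = B ; B′ = B′ ; v = b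
    ; blockB = proj₁ Bb ; blockB′ = proj₁ bB′ ; v∈B = proj₂ Bb ; v∈B′ = proj₂ bB′
    ; distinct = λ B≡B′ → B≢B′ (cong inj₂ B≡B′)
    ; joined = joined-via a refl (λ b≡a → a≢b (cong inj₁ (sym b≡a)))
                          (path⇒joined (inj₂ B′) rest (inj₁ a) back b≢rest)
                          (adj⇒joined aB) }
  cycle⇒rejoined (inj₁ _ , inj₂ _ ∷ inj₁ _ ∷ [] , _ , _ , (_ ∷ _ ∷ () ∷ _))
  cycle⇒rejoined (inj₁ _ , inj₂ _ ∷ inj₂ _ ∷ _ , _ , _ , (_ ∷ () ∷ _))
  cycle⇒rejoined (inj₁ _ , inj₁ _ ∷ _ , _ , _ , (() ∷ _))
  cycle⇒rejoined (inj₂ _ , inj₂ _ ∷ _ , _ , _ , (() ∷ _))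
  cycle⇒rejoined (inj₂ _ , inj₁ _ ∷ inj₁ _ ∷ _ , _ , _ , (_ ∷ () ∷ _))
  cycle⇒rejoined (_ , [] , s≤s () , _)
  cycle⇒rejoined (_ , _ ∷ [] , s≤s (s≤s ()) , _)

lemma3 : (n : ℕ) (G : Digraph n) → BlockGraphAcyclic G
lemma3 n G cycle = no-rejoined-blocks G (cycle⇒rejoined G cycle)
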